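{- Let $\mathcal{R}$ be an LCTRS and $P$ a set of parallel positions. If $s\ [\varphi]\xrightarrow{\parallel P}t\ [\varphi]$ (parallel step on constrained terms), then $s\delta\xrightarrow{\parallel P}t\delta$ (parallel step on terms) for all substitutions $\delta$ with $\delta\vDash\varphi$.
   Context: Logically constrained rewriting. Fix a many-sorted signature $\mathcal{F}=\mathcal{F}_{\mathrm{te}}\cup\mathcal{F}_{\mathrm{th}}$ (possibly infinite) and an infinite set $\mathcal{V}$ of sorted variables. For every sort $\iota$ of $\mathcal{F}_{\mathrm{th}}$ there is a non-empty set $\mathcal{V}\mathrm{al}_\iota\subseteq\mathcal{F}_{\mathrm{th}}$ of constants of sort $\iota$ (values); $\mathcal{V}\mathrm{al}=\bigcup_\iota\mathcal{V}\mathrm{al}_\iota$, $\mathcal{F}_{\mathrm{te}}\cap\mathcal{F}_{\mathrm{th}}\subseteq\mathcal{V}\mathrm{al}$. Logical terms are terms of $\mathcal{T}(\mathcal{F}_{\mathrm{th}},\mathcal{V})$; a fixed interpretation $\mathcal{J}$ evaluates ground logical terms to values via $[\![f(t_1,\dots,t_n)]\!]=f_{\mathcal{J}}([\![t_1]\!],\dots,[\![t_n]\!])$. Constraints are logical terms of sort $\mathsf{bool}$ (with connectives, $\Rightarrow$, equality $=$). $\varphi$ is valid if $[\![\varphi\gamma]\!]=\top$ for all $\gamma$ mapping $\mathcal{V}\mathrm{ar}(\varphi)$ to values, satisfiable if this holds for some such $\gamma$; $\sigma\vDash\varphi$ means $\sigma(x)\in\mathcal{V}\mathrm{al}$ for $x\in\mathcal{V}\mathrm{ar}(\varphi)$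 and $\varphi\sigma$ valid. A constrained rewrite rule $\rho\colon\ell\to r\ [\varphi]$: $\ell,r$ terms of the same sort, $\mathrm{root}(\ell)\in\mathcal{F}_{\mathrm{te}}\setminus\mathcal{F}_{\mathrm{th}}$, $\varphi$ a constraint; $\mathcal{LV}\mathrm{ar}(\rho)=\mathcal{V}\mathrm{ar}(\varphi)\cup(\mathcal{V}\mathrm{ar}(r)\setminus\mathcal{V}\mathrm{ar}(\ell))$. An LCTRS $\mathcal{R}$ is a set of such rules. $\sigma\vDash\rho$ means $\mathcal{D}\mathrm{om}(\sigma)=\mathcal{V}\mathrm{ar}(\ell)\cup\mathcal{V}\mathrm{ar}(r)\cup\mathcal{V}\mathrm{ar}(\varphi)$, $\sigma(x)\in\mathcal{V}\mathrm{al}$ for $x\in\mathcal{LV}\mathrm{ar}(\rho)$, $\varphi\sigma$ valid. Calculation rules: $f(x_1,\dots,x_n)\to y\ [y=f(x_1,\dots,x_n)]$ for $f\in\mathcal{F}_{\mathrm{th}}\setminus\mathcal{V}\mathrm{al}$, $y$ fresh; $\mathcal{R}_{\mathrm{rc}}$ is $\mathcal{R}$ together with them. Parallel steps on terms: $x\xrightarrow{\parallel}x$; $f(s_1,\dots,s_n)\xrightarrow{\parallel}f(t_1,\dots,t_n)$ if $s_i\xrightarrow{\parallel}t_i$ for all $i$; $\ell\sigma\xrightarrow{\parallel}r\sigma$ if $\rho\colon\ell\to r\ [\varphi]\in\mathcal{R}_{\mathrm{rc}}$ and $\sigma\vDash\rho$. Parallel steps on constrained terms $s\ [\varphi]$: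 $x\ [\varphi]\xrightarrow{\parallel}x\ [\varphi]$; $f(s_1,\dots,s_n)\ [\varphi]\xrightarrow{\parallel}f(t_1,\dots,t_n)\ [\varphi]$ if $s_i\ [\varphi]\xrightarrow{\parallel}t_i\ [\varphi]$ for all $i$; $\ell\sigma\ [\varphi]\xrightarrow{\parallel}r\sigma\ [\varphi]$ if $\rho\colon\ell\to r\ [\psi]\in\mathcal{R}_{\mathrm{rc}}$, $\sigma(x)\in\mathcal{V}\mathrm{al}\cup\mathcal{V}\mathrm{ar}(\varphi)$ for all $x\in\mathcal{LV}\mathrm{ar}(\rho)$, $\varphi$ satisfiable and $\varphi\Rightarrow\psi\sigma$ valid. For both relations, $\xrightarrow{\parallel P}$ means that each step obtained by the last (rule-application) clause is performed at a position in $P$ and no two such steps share a position. -}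

module Defs where

open import Data.Nat using (ℕ; zero; suc)
open import Data.List using (List; []; _∷_; length)
open import Data.List.Relation.Unary.All using (All; []; _∷_)
open import Data.Product using (Σ; Σ-syntax; _×_; _,_)
open import Data.Sum using (_⊎_)
open import Data.Empty using (⊥)
open import Relation.Nullary using (¬_)
open import Relation.Binary.PropositionalEquality using (_≡_; _≢_)
open import Function.Bundles using (_⇔_)
open import Function.Definitions using (Injective)

record Signature : Set₁ where
  field
    Sort   : Set
    Fun    : List Sort → Sort → Set
    Var    : Sort → Set
    fresh     : (ι : Sort) → ℕ → Var ι
    fresh-inj : (ι : Sort) → Injective _≡_ _≡_ (fresh ι)
    IsTe   : ∀ {ιs ι} → Fun ιs ι → Set
    IsTh   : ∀ {ιs ι} → Fun ιs ι → Set
    cover  : ∀ {ιs ι} (f : Fun ιs ι) → IsTe f ⊎ IsTh f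
    IsVal      : ∀ {ιs ι} → Fun ιs ι → Set
    val-const  : ∀ {ιs ι} {f : Fun ιs ι} → IsVal f → ιs ≡ []
    val-th     : ∀ {ιs ι} {f : Fun ιs ι} → IsVal f → IsTh f
    te-th-val  : ∀ {ιs ι} {f : Fun ιs ι} → IsTe f → IsTh f → IsVal f
    val-nonempty : (ι : Sort) → Σ (Fun [] ι) IsVal

  Val : Sort → Set
  Val ι = Σ (Fun [] ι) IsVal

  field
    -- the interpretation f_J (only its values on theory symbols matter)
    J      : ∀ {ιs ι} → Fun ιs ι → All Val ιs → Val ι
    J-val  : ∀ {ι} (v : Fun [] ι) (p : IsVal v) → J v [] ≡ (v , p)
    bool   : Sort
    top    : Val bool
    eqSym  : (ι : Sort) → Fun (ι ∷ ι ∷ []) bool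
    impSym : Fun (bool ∷ bool ∷ []) bool
    eq-th  : (ι : Sort) → IsTh (eqSym ι)
    imp-th : IsTh impSym
    J-eq   : ∀ {ι} (a b : Val ι) → (J (eqSym ι) (a ∷ b ∷ []) ≡ top) ⇔ (a ≡ b)
    J-imp  : (a b : Val bool) →
             (J impSym (a ∷ b ∷ []) ≡ top) ⇔ (a ≡ top → b ≡ top)

-- Positions (argument indices counted from 0)

Pos : Set
Pos = List ℕ

data _≤ₚ_ : Pos → Pos → Set where
  []≤  : ∀ {q} → [] ≤ₚ q
  ∷≤   : ∀ {i p q} → p ≤ₚ q → (i ∷ p) ≤ₚ (i ∷ q)

Parallel : (Pos → Set) → Set
Parallel P = ∀ p q → P p → P q → p ≢ q → ¬ (p ≤ₚ q) × ¬ (q ≤ₚ p)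

module Over (S : Signature) where
  open Signature S public

  mutual
    data Term : Sort → Set where
      var : ∀ {ι} → Var ι → Term ι
      app : ∀ {ιs ι} → Fun ιs ι → Terms ιs → Term ι

    data Terms : List Sort → Set where
      []  : Terms []
      _∷_ : ∀ {ι ιs} → Term ι → Terms ιs → Terms (ι ∷ ιs)

  Subst : Set
  Subst = ∀ {ι} → Var ι → Term ι

  mutual
    _⟨_⟩ : ∀ {ι} → Term ι → Subst → Term ι
    var x ⟨ σ ⟩    = σ x
    app f ts ⟨ σ ⟩ = app f (ts ⟨ σ ⟩s)

    _⟨_⟩s : ∀ {ιs} → Terms ιs → Subst → Terms ιs
    [] ⟨ σ ⟩s       = []
    (t ∷ ts) ⟨ σ ⟩s = (t ⟨ σ ⟩) ∷ (ts ⟨ σ ⟩s)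

  mutual
    data Occurs {κ} (x : Var κ) : ∀ {ι} → Term ι → Set where
      here : Occurs x (var x)
      arg  : ∀ {ιs ι} {f : Fun ιs ι} {ts} → OccursS x ts → Occurs x (app f ts)

    data OccursS {κ} (x : Var κ) : ∀ {ιs} → Terms ιs → Set where
      hd : ∀ {ι ιs} {t : Term ι} {ts : Terms ιs} → Occurs x t → OccursS x (t ∷ ts)
      tl : ∀ {ι ιs} {t : Term ι} {ts : Terms ιs} → OccursS x ts → OccursS x (t ∷ ts)

  mutual
    data Logical : ∀ {ι} → Term ι → Set where
      var : ∀ {ι} {x : Var ι} → Logical (var x)
      app : ∀ {ιs ι} {f : Fun ιs ι} {ts} → IsTh f → LogicalS ts → Logical (app f ts)

    data LogicalS : ∀ {ιs} → Terms ιs → Set where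
      []  : LogicalS []
      _∷_ : ∀ {ι ιs} {t : Term ι} {ts : Terms ιs} → Logical t → LogicalS ts → LogicalS (t ∷ ts)

  data IsValTerm : ∀ {ι} → Term ι → Set where
    val : ∀ {ι} {v : Fun [] ι} → IsVal v → IsValTerm (app v [])

  -- evaluation under an assignment of values to variables:
  -- ⟦ t ⟧ γ is the interpretation of the ground term t γ
  Assignment : Set
  Assignment = ∀ {ι} → Var ι → Val ι

  mutual
    ⟦_⟧ : ∀ {ι} → Term ι → Assignment → Val ι
    ⟦ var x ⟧ γ    = γ x
    ⟦ app f ts ⟧ γ = J f (⟦ ts ⟧s γ)

    ⟦_⟧s : ∀ {ιs} → Terms ιs → Assignment → All Val ιs
    ⟦ [] ⟧s γ       = []
    ⟦ t ∷ ts ⟧s γ   = ⟦ t ⟧ γ ∷ ⟦ ts ⟧s γ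

  Valid : Term bool → Set
  Valid φ = ∀ (γ : Assignment) → ⟦ φ ⟧ γ ≡ top

  Satisfiable : Term bool → Set
  Satisfiable φ = Σ Assignment λ γ → ⟦ φ ⟧ γ ≡ top

  _⇒_ : Term bool → Term bool → Term bool
  φ ⇒ ψ = app impSym (φ ∷ ψ ∷ [])

  _⊨_ : Subst → Term bool → Set
  σ ⊨ φ = (∀ {κ} (x : Var κ) → Occurs x φ → IsValTerm (σ x)) × Valid (φ ⟨ σ ⟩)

  record Rule : Set where
    constructor _⟶_[_]
    field
      {sort} : Sort
      lhs    : Term sort
      rhs    : Term sort
      con    : Term bool
  open Rule public

  RootTe : ∀ {ι} → Term ι → Set
  RootTe (var x)    = ⊥
  RootTe (app f ts) = IsTe f × ¬ IsTh f

  record LCTRS : Set₁ where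
    field
      rules    : Rule → Set
      rule-wf  : ∀ ρ → rules ρ → RootTe (lhs ρ) × Logical (con ρ)
  open LCTRS public

  LV : Rule → ∀ {κ} → Var κ → Set
  LV ρ x = Occurs x (con ρ) ⊎ (Occurs x (rhs ρ) × ¬ Occurs x (lhs ρ))

  -- σ ⊨ ρ  (domain condition omitted: substitutions are total)
  _⊨ʳ_ : Subst → Rule → Set
  σ ⊨ʳ ρ = (∀ {κ} (x : Var κ) → LV ρ x → IsValTerm (σ x)) × Valid (con ρ ⟨ σ ⟩)

  argVars : (ιs : List Sort) → ℕ → Terms ιs
  argVars []       k = []
  argVars (κ ∷ κs) k = var (fresh κ k) ∷ argVars κs (suc k)

  calcRule : ∀ {ιs ι} → Fun ιs ι → Rule
  calcRule {ιs} {ι} f =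
    let y = var (fresh ι (length ιs)) ; fx = app f (argVars ιs 0) in
    fx ⟶ y [ app (eqSym ι) (y ∷ fx ∷ []) ]

  data _∈rc_ (ρ : Rule) (R : LCTRS) : Set where
    orig : rules R ρ → ρ ∈rc R
    calc : ∀ {ιs ι} (f : Fun ιs ι) → IsTh f → ¬ IsVal f → ρ ≡ calcRule f → ρ ∈rc R

  module _ (R : LCTRS) where
    mutual
      data PStep : ∀ {ι} → (Pos → Set) → Term ι → Term ι → Set₁ where
        pvar  : ∀ {ι P} {x : Var ι} → PStep P (var x) (var x)
        pcong : ∀ {ιs ι P} {f : Fun ιs ι} {ss ts} →
                PStepS 0 P ss ts → PStep P (app f ss) (app f ts)
        prule : ∀ {P} (ρ : Rule) (σ : Subst) → ρ ∈rc R → σ ⊨ʳ ρ → P [] →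
                PStep P (lhs ρ ⟨ σ ⟩) (rhs ρ ⟨ σ ⟩)

      data PStepS : ∀ {ιs} → ℕ → (Pos → Set) → Terms ιs → Terms ιs → Set₁ where
        []  : ∀ {k P} → PStepS k P [] []
        _∷_ : ∀ {ι ιs k P} {s t : Term ι} {ss ts : Terms ιs} →
              PStep (λ p → P (k ∷ p)) s t → PStepS (suc k) P ss ts →
              PStepS k P (s ∷ ss) (t ∷ ts)

    mutual
      data CStep (φ : Term bool) : ∀ {ι} → (Pos → Set) → Term ι → Term ι → Set₁ where
        cvar  : ∀ {ι P} {x : Var ι} → CStep φ P (var x) (var x)
        ccong : ∀ {ιs ι P} {f : Fun ιs ι} {ss ts} →
                CStepS φ 0 P ss ts → CStep φ P (app f ss) (app f ts)
        crule : ∀ {P} (ρ : Rule) (σ : Subst) → ρ ∈rc R →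
                (∀ {κ} (x : Var κ) → LV ρ x →
                   IsValTerm (σ x) ⊎ Σ[ y ∈ Var κ ] (σ x ≡ var y × Occurs y φ)) →
                Satisfiable φ → Valid (φ ⇒ (con ρ ⟨ σ ⟩)) → P [] →
                CStep φ P (lhs ρ ⟨ σ ⟩) (rhs ρ ⟨ σ ⟩)

      data CStepS (φ : Term bool) : ∀ {ιs} → ℕ → (Pos → Set) → Terms ιs → Terms ιs → Set₁ where
        []  : ∀ {k P} → CStepS φ k P [] []
        _∷_ : ∀ {ι ιs k P} {s t : Term ι} {ss ts : Terms ιs} →
              CStep φ (λ p → P (k ∷ p)) s t → CStepS φ (suc k) P ss ts →
              CStepS φ k P (s ∷ ss) (t ∷ ts)

module Submission where

open import Defs
import Data.List.Relation.Unary.All as All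
open import Data.Product using (_,_; proj₁; proj₂)
open import Data.Sum using (inj₁; inj₂)
open import Relation.Binary.PropositionalEquality
  using (_≡_; refl; sym; trans; cong; cong₂; subst; subst₂; module ≡-Reasoning)
open import Function.Bundles using (Equivalence)

-- Instantiate the constrained step with δ: every rule instance ℓσ → rσ
-- becomes ℓ(σδ) → r(σδ). Logical variables of ρ are sent by σ to values or
-- to variables of φ, which δ ⊨ φ sends to values; and the constraint of ρ
-- holds under σδ because φ ⇒ ψσ is valid and φδ is valid.

module _ (S : Signature) where
  open Over S

  infixl 5 _∘ₛ_

  _∘ₛ_ : Subst → Subst → Subst
  (σ ∘ₛ δ) x = σ x ⟨ δ ⟩

  mutual
    ⟨⟩-∘ₛ : ∀ {ι} (t : Term ι) (σ δ : Subst) → t ⟨ σ ⟩ ⟨ δ ⟩ ≡ t ⟨ σ ∘ₛ δ ⟩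
    ⟨⟩-∘ₛ (var x)    σ δ = refl
    ⟨⟩-∘ₛ (app f ts) σ δ = cong (app f) (⟨⟩s-∘ₛ ts σ δ)

    ⟨⟩s-∘ₛ : ∀ {ιs} (ts : Terms ιs) (σ δ : Subst) → ts ⟨ σ ⟩s ⟨ δ ⟩s ≡ ts ⟨ σ ∘ₛ δ ⟩s
    ⟨⟩s-∘ₛ []       σ δ = refl
    ⟨⟩s-∘ₛ (t ∷ ts) σ δ = cong₂ _∷_ (⟨⟩-∘ₛ t σ δ) (⟨⟩s-∘ₛ ts σ δ)

  _⨟⟦_⟧ : Subst → Assignment → Assignment
  (δ ⨟⟦ γ ⟧) x = ⟦ δ x ⟧ γ

  mutual
    ⟦⟨⟩⟧ : ∀ {ι} (t : Term ι) (δ : Subst) (γ : Assignment) →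
           ⟦ t ⟨ δ ⟩ ⟧ γ ≡ ⟦ t ⟧ (δ ⨟⟦ γ ⟧)
    ⟦⟨⟩⟧ (var x)    δ γ = refl
    ⟦⟨⟩⟧ (app f ts) δ γ = cong (J f) (⟦⟨⟩s⟧ ts δ γ)

    ⟦⟨⟩s⟧ : ∀ {ιs} (ts : Terms ιs) (δ : Subst) (γ : Assignment) →
            ⟦ ts ⟨ δ ⟩s ⟧s γ ≡ ⟦ ts ⟧s (δ ⨟⟦ γ ⟧)
    ⟦⟨⟩s⟧ []       δ γ = refl
    ⟦⟨⟩s⟧ (t ∷ ts) δ γ = cong₂ All._∷_ (⟦⟨⟩⟧ t δ γ) (⟦⟨⟩s⟧ ts δ γ)

  IsValTerm-⟨⟩ : ∀ {ι} {t : Term ι} (δ : Subst) → IsValTerm t → IsValTerm (t ⟨ δ ⟩)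
  IsValTerm-⟨⟩ δ (val v) = val v

  Valid-⇒-⟨⟩ : ∀ φ ψ (δ : Subst) → Valid (φ ⇒ ψ) → Valid (φ ⟨ δ ⟩) → Valid (ψ ⟨ δ ⟩)
  Valid-⇒-⟨⟩ φ ψ δ φ⇒ψ φδ γ = begin
    ⟦ ψ ⟨ δ ⟩ ⟧ γ       ≡⟨ ⟦⟨⟩⟧ ψ δ γ ⟩
    ⟦ ψ ⟧ (δ ⨟⟦ γ ⟧)    ≡⟨ Equivalence.to (J-imp _ _) (φ⇒ψ (δ ⨟⟦ γ ⟧)) φ-holds ⟩
    top                 ∎
    where
    open ≡-Reasoning
    φ-holds : ⟦ φ ⟧ (δ ⨟⟦ γ ⟧) ≡ top
    φ-holds = trans (sym (⟦⟨⟩⟧ φ δ γ)) (φδ γ)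

  module _ (R : LCTRS) where

    mutual
      PStep-refl : ∀ {ι P} (t : Term ι) → PStep R P t t
      PStep-refl (var x)    = pvar
      PStep-refl (app f ts) = pcong (PStepS-refl ts)

      PStepS-refl : ∀ {ιs k P} (ts : Terms ιs) → PStepS R k P ts ts
      PStepS-refl []       = []
      PStepS-refl (t ∷ ts) = PStep-refl t ∷ PStepS-refl ts

    module _ {φ : Term bool} {δ : Subst} (δ⊨φ : δ ⊨ φ) where

      mutual
        CStep⇒PStep : ∀ {ι P} {s t : Term ι} → CStep R φ P s t →
                      PStep R P (s ⟨ δ ⟩) (t ⟨ δ ⟩)
        CStep⇒PStep (cvar {x = x}) = PStep-refl (δ x)
        CStep⇒PStep (ccong ss→ts)  = pcong (CStepS⇒PStepS ss→ts)
        CStep⇒PStep {P = P} (crule ρ σ ρ∈R σ-LV _ φ⇒ψσ p∈P) =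
          subst₂ (PStep R P) (sym (⟨⟩-∘ₛ (lhs ρ) σ δ)) (sym (⟨⟩-∘ₛ (rhs ρ) σ δ))
            (prule ρ (σ ∘ₛ δ) ρ∈R (σδ-LV , σδ-con) p∈P)
          where
          σδ-LV : ∀ {κ} (x : Var κ) → LV ρ x → IsValTerm ((σ ∘ₛ δ) x)
          σδ-LV x x∈LV with σ-LV x x∈LV
          ... | inj₁ σx-val              = IsValTerm-⟨⟩ δ σx-val
          ... | inj₂ (y , σx≡y , y∈φ) rewrite σx≡y = proj₁ δ⊨φ y y∈φ

          σδ-con : Valid (con ρ ⟨ σ ∘ₛ δ ⟩)
          σδ-con = subst Valid (⟨⟩-∘ₛ (con ρ) σ δ)
                         (Valid-⇒-⟨⟩ φ (con ρ ⟨ σ ⟩) δ φ⇒ψσ (proj₂ δ⊨φ))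

        CStepS⇒PStepS : ∀ {ιs k P} {ss ts : Terms ιs} → CStepS R φ k P ss ts →
                        PStepS R k P (ss ⟨ δ ⟩s) (ts ⟨ δ ⟩s)
        CStepS⇒PStepS []            = []
        CStepS⇒PStepS (s→t ∷ ss→ts) = CStep⇒PStep s→t ∷ CStepS⇒PStepS ss→ts

lemma12 : (S : Signature) → let open Over S in
    (R : LCTRS) (P : Pos → Set) → Parallel P →
    (φ : Term bool) → Logical φ →
    ∀ {ι} (s t : Term ι) → CStep R φ P s t →
    (δ : Subst) → δ ⊨ φ → PStep R P (s ⟨ δ ⟩) (t ⟨ δ ⟩)
lemma12 S R P _ φ _ s t s→t δ δ⊨φ = CStep⇒PStep S R δ⊨φ s→t
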